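{- Let $\vec H_1$ be a directed Hamilton cycle on a finite vertex set $V$, and let $H_2$ be a connected $d$-regular graph on $V$ which is edge-disjoint from the underlying undirected cycle $H_1$ of $\vec H_1$, such that the graph $H=H_1\cup H_2$ is not bipartite. Then for every pair of vertices $v,u\in V$ there exists an $H_2\vec H_1$-alternating path from $v$ to $u$.
   Context: Each edge of $H_2$ is regarded as a pair of directed edges with opposite orientations, so it may be traversed in either direction; edges of $\vec H_1$ may be traversed only in their given orientation. A directed path from $v$ to $u$ is called $H_2\vec H_1$-alternating if its first edge is an edge of $H_2$, its last edge is an edge of $\vec H_1$, and its edges belong alternately to $H_2$ and to $\vec H_1$. -}

module Defs where

open import Data.Nat using (ℕ; zero; suc; _≤_)
open import Data.Fin using (Fin)
open import Data.Bool using (Bool; true; false)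
open import Data.List using (List; length; filterᵇ; allFin)
open import Data.Product using (Σ; ∃; _×_; _,_)
open import Data.Sum using (_⊎_)
open import Relation.Binary.PropositionalEquality using (_≡_; _≢_)
open import Relation.Nullary using (¬_)
open import Function.Definitions using (Injective)

iter : ∀ {A : Set} → (A → A) → ℕ → A → A
iter f zero    x = x
iter f (suc k) x = f (iter f k x)

-- A directed Hamilton cycle on the vertex set Fin n, given by its successor map s:
-- the arcs are v → s v; s is injective and a single cycle through all vertices.
-- (n ≥ 3 so that the underlying undirected cycle is a simple graph.)
record DirHamCycle (n : ℕ) : Set where
  field
    succ      : Fin n → Fin n
    three≤n   : 3 ≤ n
    injective : Injective _≡_ _≡_ succ
    cyclic    : ∀ v u → ∃ λ k → iter succ k v ≡ u

H1Adj : ∀ {n} → DirHamCycle n → Fin n → Fin n → Set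
H1Adj C v u = (u ≡ DirHamCycle.succ C v) ⊎ (v ≡ DirHamCycle.succ C u)

record SimpleGraph (n : ℕ) : Set where
  field
    adj     : Fin n → Fin n → Bool
    sym     : ∀ v u → adj v u ≡ adj u v
    irrefl  : ∀ v → adj v v ≡ false

Adj : ∀ {n} → SimpleGraph n → Fin n → Fin n → Set
Adj G v u = SimpleGraph.adj G v u ≡ true

degree : ∀ {n} → SimpleGraph n → Fin n → ℕ
degree {n} G v = length (filterᵇ (SimpleGraph.adj G v) (allFin n))

Regular : ∀ {n} → ℕ → SimpleGraph n → Set
Regular d G = ∀ v → degree G v ≡ d

data Walk {n : ℕ} (R : Fin n → Fin n → Set) : Fin n → Fin n → Set where
  nil  : ∀ {v} → Walk R v v
  cons : ∀ {v w u} → R v w → Walk R w u → Walk R v u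

Connected : ∀ {n} → SimpleGraph n → Set
Connected {n} G = ∀ (v u : Fin n) → Walk (Adj G) v u

EdgeDisjoint : ∀ {n} → DirHamCycle n → SimpleGraph n → Set
EdgeDisjoint C G = ∀ v u → H1Adj C v u → ¬ Adj G v u

UnionAdj : ∀ {n} → DirHamCycle n → SimpleGraph n → Fin n → Fin n → Set
UnionAdj C G v u = H1Adj C v u ⊎ Adj G v u

Bipartite : ∀ {n} → (Fin n → Fin n → Set) → Set
Bipartite {n} R = Σ (Fin n → Bool) λ c → ∀ v u → R v u → c v ≢ c u

-- H₂H⃗₁-alternating (directed) walk from v to u: first edge in H₂ (either direction),
-- then an arc w → succ w of H⃗₁, alternating, last edge in H⃗₁.
data AltPath {n : ℕ} (C : DirHamCycle n) (G : SimpleGraph n) : Fin n → Fin n → Set where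
  last : ∀ {v w} → Adj G v w → AltPath C G v (DirHamCycle.succ C w)
  step : ∀ {v w u} → Adj G v w → AltPath C G (DirHamCycle.succ C w) u → AltPath C G v u

-- Let S be the set of endpoints of alternating paths from v. S is closed under x ↦ succ w
-- for every H₂-edge xw. Counting incidences between S and its preimage under succ, using
-- d-regularity and bijectivity of succ, shows the converse: succ w ∈ S forces x ∈ S. Hence two
-- vertices with a common H₂-neighbour lie on the same side of S, and by connectivity either S
-- is everything or its indicator properly 2-colours H₂, and then H₁ too, since a and succ a
-- are separated through any H₂-neighbour of a. The latter contradicts non-bipartiteness.
module Submission where

open import Defs
open import Data.Nat using (ℕ; zero; suc; _+_; _*_; _≤_; z≤n; s≤s)
open import Data.Nat.Properties
  using (+-*-semiring; ≤-refl; ≤-antisym; <⇒≤; +-mono-≤; +-monoʳ-≤; +-cancelʳ-≤; +-cancelˡ-≡; +-identityʳ)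
open import Data.Fin using (Fin; _≟_)
open import Data.Fin.Properties using (any?)
open import Data.Fin.Subset using (Subset; _∈_; _⊆_; _⊂_; _⊃_; _∪_; ⁅_⁆)
open import Data.Fin.Subset.Properties using (_∈?_; x∈⁅x⁆; x∈⁅y⁆⇒x≡y; p⊆p∪q; q⊆p∪q; x∈p∪q⁻)
open import Data.Fin.Subset.Induction using (⊃-wellFounded)
open import Data.Fin.Permutation using (Permutation; permutation; _⟨$⟩ʳ_)
open import Data.Bool using (Bool; true; false; _∧_)
open import Data.Bool.Properties using (∧-conicalˡ; ∧-conicalʳ; ⇔→≡)
import Data.Bool.Properties as Bool
open import Data.List using (length; filterᵇ; tabulate)
open import Data.Vec using (lookup)
open import Data.Vec.Properties using ([]=⇒lookup; lookup⇒[]=)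
open import Data.Product using (∃; _×_; _,_; proj₁; proj₂)
open import Data.Sum using (inj₁; inj₂)
open import Data.Empty using (⊥-elim)
open import Function using (id; _∘_)
open import Function.Bundles using (mk⇔)
open import Level using (0ℓ)
open import Induction.WellFounded using (Acc; acc)
open import Relation.Binary using (Rel; Decidable)
open import Relation.Unary using (Pred)
open import Relation.Nullary using (¬_; yes; no)
open import Relation.Nullary.Decidable using (_×-dec_; ¬?; decidable-stable)
open import Relation.Binary.PropositionalEquality using (_≡_; _≢_; refl; sym; trans; cong; cong₂; subst; module ≡-Reasoning)
open import Algebra.Properties.Semiring.Sum +-*-semiring using (sum; sum-cong-≗; ∑-comm; ∑-permute; *-distribˡ-sum)

χ : Bool → ℕ
χ true  = 1
χ false = 0

χ-∧ : ∀ a b → χ (a ∧ b) ≡ χ a * χ b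
χ-∧ true  b = sym (+-identityʳ (χ b))
χ-∧ false b = refl

χ-mono : ∀ {a b} → (a ≡ true → b ≡ true) → χ a ≤ χ b
χ-mono {true}  a⇒b rewrite a⇒b refl = ≤-refl
χ-mono {false} a⇒b = z≤n

χ≡1⇒true : ∀ {a} → χ a ≡ 1 → a ≡ true
χ≡1⇒true {true} _ = refl

+-≤-≡⇒≡ : ∀ {a b c d} → a ≤ b → c ≤ d → a + c ≡ b + d → a ≡ b × c ≡ d
+-≤-≡⇒≡ {a} {b} {c} {d} a≤b c≤d eq = a≡b , +-cancelˡ-≡ a c d (trans eq (cong (_+ d) (sym a≡b)))
  where
  a≡b : a ≡ b
  a≡b = ≤-antisym a≤b (+-cancelʳ-≤ c b a (subst (b + c ≤_) (sym eq) (+-monoʳ-≤ b c≤d)))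

∑-mono-≤ : ∀ {m} {f g : Fin m → ℕ} → (∀ i → f i ≤ g i) → sum f ≤ sum g
∑-mono-≤ {zero}  f≤g = z≤n
∑-mono-≤ {suc m} f≤g = +-mono-≤ (f≤g Fin.zero) (∑-mono-≤ (f≤g ∘ Fin.suc))

∑-≤-≡⇒≡ : ∀ {m} {f g : Fin m → ℕ} → (∀ i → f i ≤ g i) → sum f ≡ sum g → ∀ i → f i ≡ g i
∑-≤-≡⇒≡ {suc m} f≤g eq i with +-≤-≡⇒≡ (f≤g Fin.zero) (∑-mono-≤ (f≤g ∘ Fin.suc)) eq
∑-≤-≡⇒≡ {suc m} f≤g eq Fin.zero    | eq₀ , _   = eq₀
∑-≤-≡⇒≡ {suc m} f≤g eq (Fin.suc i) | _   , eq₁ = ∑-≤-≡⇒≡ (f≤g ∘ Fin.suc) eq₁ i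

length-filterᵇ-tabulate : ∀ {A : Set} {m} (p : A → Bool) (f : Fin m → A) →
  length (filterᵇ p (tabulate f)) ≡ sum (χ ∘ p ∘ f)
length-filterᵇ-tabulate {m = zero}  p f = refl
length-filterᵇ-tabulate {m = suc m} p f with p (f Fin.zero)
... | true  = cong suc (length-filterᵇ-tabulate p (f ∘ Fin.suc))
... | false = length-filterᵇ-tabulate p (f ∘ Fin.suc)

Closed : ∀ {n ℓ} → Rel (Fin n) ℓ → Subset n → Set ℓ
Closed R p = ∀ {x y} → x ∈ p → R x y → y ∈ p

module _ {n ℓ} {R : Rel (Fin n) ℓ} (R? : Decidable R) where

  closure : ∀ {ℓ′} {P : Pred (Fin n) ℓ′} → (∀ {x y} → P x → R x y → P y) →
    (p : Subset n) → (∀ {x} → x ∈ p → P x) →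
    ∃ λ q → p ⊆ q × Closed R q × (∀ {x} → x ∈ q → P x)
  closure {P = P} P-closed p p⊆P = grow p p⊆P (⊃-wellFounded p)
    where
    grow : ∀ p → (∀ {x} → x ∈ p → P x) → Acc _⊃_ p →
      ∃ λ q → p ⊆ q × Closed R q × (∀ {x} → x ∈ q → P x)
    grow p p⊆P (acc larger)
      with any? (λ x → any? λ y → x ∈? p ×-dec R? x y ×-dec ¬? (y ∈? p))
    ... | no noExit = p , id , closed , p⊆P
      where
      closed : Closed R p
      closed {x} {y} x∈p Rxy = decidable-stable (y ∈? p) λ y∉p → noExit (x , y , x∈p , Rxy , y∉p)
    ... | yes (x , y , x∈p , Rxy , y∉p) with grow (p ∪ ⁅ y ⁆) p∪y⊆P (larger p⊂p∪y)
      where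
      p∪y⊆P : ∀ {z} → z ∈ p ∪ ⁅ y ⁆ → P z
      p∪y⊆P {z} z∈p∪y with x∈p∪q⁻ p ⁅ y ⁆ z∈p∪y
      ... | inj₁ z∈p = p⊆P z∈p
      ... | inj₂ z∈y = subst P (sym (x∈⁅y⁆⇒x≡y y z∈y)) (P-closed (p⊆P x∈p) Rxy)
      p⊂p∪y : p ⊂ p ∪ ⁅ y ⁆
      p⊂p∪y = p⊆p∪q ⁅ y ⁆ , y , q⊆p∪q p ⁅ y ⁆ (x∈⁅x⁆ y) , y∉p
    ... | q , p∪y⊆q , q-closed , q⊆P = q , p∪y⊆q ∘ p⊆p∪q ⁅ y ⁆ , q-closed , q⊆P

module _ {n d} (G : SimpleGraph n) (regular : Regular d G) where
  open SimpleGraph G using (adj) renaming (sym to adj-sym)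
  open ≡-Reasoning

  ∑-neighbours : ∀ x → sum (λ w → χ (adj x w)) ≡ d
  ∑-neighbours x = trans (sym (length-filterᵇ-tabulate (adj x) id)) (regular x)

  ∑-incidences : (X : Fin n → Bool) →
    sum (λ x → sum (λ w → χ (X x ∧ adj x w))) ≡ sum (λ x → χ (X x) * d)
  ∑-incidences X = sum-cong-≗ λ x → begin
    sum (λ w → χ (X x ∧ adj x w))      ≡⟨ sum-cong-≗ (λ w → χ-∧ (X x) (adj x w)) ⟩
    sum (λ w → χ (X x) * χ (adj x w))  ≡⟨ sym (*-distribˡ-sum (χ (X x)) (χ ∘ adj x)) ⟩
    χ (X x) * sum (λ w → χ (adj x w))  ≡⟨ cong (χ (X x) *_) (∑-neighbours x) ⟩
    χ (X x) * d                        ∎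

  -- Since π is a bijection, the incidences xw with x ∈ X and those with π w ∈ X both number
  -- d·|X|; closedness includes the former in the latter, so they coincide.
  shift-closed⇒shift-coclosed : (π : Permutation n n) (X : Fin n → Bool) →
    (∀ {x w} → Adj G x w → X x ≡ true → X (π ⟨$⟩ʳ w) ≡ true) →
    ∀ {x w} → Adj G x w → X (π ⟨$⟩ʳ w) ≡ true → X x ≡ true
  shift-closed⇒shift-coclosed π X closed {x} {w} xw Xπw =
    ∧-conicalˡ (X x) (adj x w) (χ≡1⇒true (trans incidence-at-x (cong χ Xπw∧wx)))
    where
    Y : Fin n → Bool
    Y = X ∘ (π ⟨$⟩ʳ_)

    from-X≤to-Y : ∀ x w → χ (X x ∧ adj x w) ≤ χ (Y w ∧ adj w x)
    from-X≤to-Y x w = χ-mono λ Xx∧xw →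
      let xw = ∧-conicalʳ (X x) (adj x w) Xx∧xw
      in cong₂ _∧_ (closed xw (∧-conicalˡ (X x) (adj x w) Xx∧xw)) (trans (adj-sym w x) xw)

    totals : sum (λ x → sum (λ w → χ (X x ∧ adj x w))) ≡ sum (λ x → sum (λ w → χ (Y w ∧ adj w x)))
    totals = begin
      sum (λ x → sum (λ w → χ (X x ∧ adj x w)))  ≡⟨ ∑-incidences X ⟩
      sum (λ x → χ (X x) * d)                    ≡⟨ ∑-permute (λ x → χ (X x) * d) π ⟩
      sum (λ w → χ (Y w) * d)                    ≡⟨ sym (∑-incidences Y) ⟩
      sum (λ w → sum (λ x → χ (Y w ∧ adj w x)))  ≡⟨ ∑-comm (λ w x → χ (Y w ∧ adj w x)) ⟩
      sum (λ x → sum (λ w → χ (Y w ∧ adj w x)))  ∎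

    incidence-at-x : χ (X x ∧ adj x w) ≡ χ (Y w ∧ adj w x)
    incidence-at-x = ∑-≤-≡⇒≡ (from-X≤to-Y x)
      (∑-≤-≡⇒≡ (λ x → ∑-mono-≤ (from-X≤to-Y x)) totals x) w

    Xπw∧wx : Y w ∧ adj w x ≡ true
    Xπw∧wx = cong₂ _∧_ Xπw (trans (adj-sym w x) xw)

another-vertex : ∀ {n} → 2 ≤ n → (a : Fin n) → ∃ λ b → b ≢ a
another-vertex (s≤s (s≤s _)) Fin.zero    = Fin.suc Fin.zero , λ ()
another-vertex (s≤s (s≤s _)) (Fin.suc _) = Fin.zero , λ ()

walk-≢⇒first-step : ∀ {n} {R : Rel (Fin n) _} {a b} → Walk R a b → b ≢ a → ∃ (R a)
walk-≢⇒first-step nil        b≢a = ⊥-elim (b≢a refl)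
walk-≢⇒first-step (cons r _) _   = _ , r

connected⇒neighbour : ∀ {n} {G : SimpleGraph n} → 2 ≤ n → Connected G → ∀ a → ∃ (Adj G a)
connected⇒neighbour 2≤n connected a =
  let b , b≢a = another-vertex 2≤n a in walk-≢⇒first-step (connected a b) b≢a

Adj-sym : ∀ {n} (G : SimpleGraph n) {a b} → Adj G a b → Adj G b a
Adj-sym G {a} {b} ab = trans (SimpleGraph.sym G b a) ab

module _ {n} (C : DirHamCycle n) where
  open DirHamCycle C using (succ)

  -- y is reached from succ y, so the vertex visited just before y is its predecessor.
  predecessor : ∀ y → ∃ λ x → succ x ≡ y
  predecessor y with DirHamCycle.cyclic C (succ y) y
  ... | zero  , succy≡y = y , succy≡y
  ... | suc k , e       = iter succ k (succ y) , e

  succ-permutation : Permutation n n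
  succ-permutation = permutation succ (proj₁ ∘ predecessor) (proj₂ ∘ predecessor)
    (λ x → DirHamCycle.injective C (proj₂ (predecessor (succ x))))

  module _ (G : SimpleGraph n) (connected : Connected G) (c : Fin n → Bool)
    (compatible : ∀ {x w} → Adj G x w → c x ≡ c (succ w)) where

    monochromatic-edge⇒constant : ∀ {a b} → Adj G a b → c a ≡ c b → ∀ u → c u ≡ c a
    monochromatic-edge⇒constant {a} ab ca≡cb u = spread (connected a u) ab ca≡cb
      where
      spread : ∀ {a b u} → Walk (Adj G) a u → Adj G a b → c a ≡ c b → c u ≡ c a
      spread nil _ _ = refl
      spread {a} (cons {w = a′} aa′ walk) ab ca≡cb = trans (spread walk (Adj-sym G aa′) ca′≡ca) ca′≡ca
        where
        ca′≡ca : c a′ ≡ c a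
        ca′≡ca = trans (compatible (Adj-sym G aa′)) (trans (sym (compatible (Adj-sym G ab))) (sym ca≡cb))

    nonconstant⇒proper : ∀ {y z} → c y ≢ c z → (∀ a → ∃ (Adj G a)) →
      ∀ a b → UnionAdj C G a b → c a ≢ c b
    nonconstant⇒proper {y} {z} cy≢cz neighbour = proper
      where
      H₂-proper : ∀ {a b} → Adj G a b → c a ≢ c b
      H₂-proper ab ca≡cb = cy≢cz (trans (monochromatic-edge⇒constant ab ca≡cb y)
                                        (sym (monochromatic-edge⇒constant ab ca≡cb z)))
      H₁-proper : ∀ a → c a ≢ c (succ a)
      H₁-proper a ca≡csa = let b , ab = neighbour a in
        H₂-proper (Adj-sym G ab) (trans (compatible (Adj-sym G ab)) (sym ca≡csa))
      proper : ∀ a b → UnionAdj C G a b → c a ≢ c b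
      proper a _ (inj₁ (inj₁ refl)) = H₁-proper a
      proper _ b (inj₁ (inj₂ refl)) = H₁-proper b ∘ sym
      proper a b (inj₂ ab)          = H₂-proper ab

module _ {n} (C : DirHamCycle n) (G : SimpleGraph n) where
  open DirHamCycle C using (succ)

  AltStep : Rel (Fin n) 0ℓ
  AltStep x y = ∃ λ w → Adj G x w × succ w ≡ y

  altStep? : Decidable AltStep
  altStep? x y = any? λ w → (SimpleGraph.adj G x w Bool.≟ true) ×-dec (succ w ≟ y)

  AltPath-extend : ∀ {v x y} → AltPath C G v x → AltStep x y → AltPath C G v y
  AltPath-extend (last vw)   (_ , xw , refl) = step vw (last xw)
  AltPath-extend (step vw p) xy              = step vw (AltPath-extend p xy)

  alternating-closure : ∀ {v w₀} → Adj G v w₀ →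
    ∃ λ S → succ w₀ ∈ S × Closed AltStep S × (∀ {x} → x ∈ S → AltPath C G v x)
  alternating-closure {v} {w₀} vw₀ =
    let S , seed⊆S , S-closed , S⊆AltPath = closure altStep? AltPath-extend ⁅ succ w₀ ⁆ seed⊆AltPath
    in S , seed⊆S (x∈⁅x⁆ (succ w₀)) , S-closed , S⊆AltPath
    where
    seed⊆AltPath : ∀ {x} → x ∈ ⁅ succ w₀ ⁆ → AltPath C G v x
    seed⊆AltPath x∈seed = subst (AltPath C G v) (sym (x∈⁅y⁆⇒x≡y (succ w₀) x∈seed)) (last vw₀)

  closed⇒compatible : ∀ {d} → Regular d G → (S : Subset n) → Closed AltStep S →
    ∀ {x w} → Adj G x w → lookup S x ≡ lookup S (succ w)
  closed⇒compatible regular S closed xw = ⇔→≡ (mk⇔ (forward xw)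
    (shift-closed⇒shift-coclosed G regular (succ-permutation C) (lookup S) forward xw))
    where
    forward : ∀ {x w} → Adj G x w → lookup S x ≡ true → lookup S (succ w) ≡ true
    forward {x} xw Sx = []=⇒lookup (closed (lookup⇒[]= x S Sx) (_ , xw , refl))

lemma3 : (n d : ℕ) (C : DirHamCycle n) (H₂ : SimpleGraph n) →
    Regular d H₂ → Connected H₂ → EdgeDisjoint C H₂ →
    ¬ Bipartite (UnionAdj C H₂) →
    (v u : Fin n) → AltPath C H₂ v u
lemma3 n d C H₂ regular connected _ non-bipartite v u
  with neighbour ← connected⇒neighbour {G = H₂} (<⇒≤ (DirHamCycle.three≤n C)) connected
  with w₀ , vw₀ ← neighbour v
  with S , w₀⁺∈S , S-closed , S⊆AltPath ← alternating-closure C H₂ vw₀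
  with u ∈? S
... | yes u∈S = S⊆AltPath u∈S
... | no  u∉S = ⊥-elim (non-bipartite (lookup S ,
  nonconstant⇒proper C H₂ connected (lookup S) (closed⇒compatible C H₂ regular S S-closed)
    (λ same → u∉S (lookup⇒[]= u S (trans (sym same) ([]=⇒lookup w₀⁺∈S)))) neighbour))
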